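{- For every integer $n\ge 0$, $$s_n=\sum_{k=0}^{\lfloor n/2\rfloor}\binom{n-k}{n-2k}d_{n-2k},$$ where $d_n$ denotes the number of symmetric Dyck paths of length $2n$ and $s_n$ denotes the number of symmetric Schröder paths of length $2n$.
   Context: Steps: up step $U=(1,1)$, down step $D=(1,-1)$, 2-horizontal step $H=(2,0)$. A Dyck path of length $2n$ is a lattice path from $(0,0)$ to $(2n,0)$ using steps $U,D$ that never goes below the $x$-axis; a Schröder path of length $2n$ is the same but steps $U,D,H$ are allowed. A path of length $2n$ is symmetric if it passes through a lattice point with $x$-coordinate $n$ (so in particular no $H$ step goes from $x=n-1$ to $x=n+1$) and its part on $[n,2n]$ is the mirror image of its part on $[0,n]$ under the reflection $x\mapsto 2n-x$. Thus $d_n=\binom{n}{\lfloor n/2\rfloor}$ counts symmetric Dyck paths of length $2n$ and $s_n$ ($1,1,3,5,13,25,63,\dots$) counts symmetric Schröder paths of length $2n$. -}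

module Defs where

open import Data.Nat using (ℕ; zero; suc; _+_; _*_; _∸_; _≡ᵇ_)
open import Data.Bool using (Bool; true; false; _∧_; _∨_; not)
open import Data.List using (List; []; _∷_; _++_; map; concatMap; length; filterᵇ; reverse; upTo)
open import Data.Bool.ListAction using (any)
open import Data.Product using (_×_; _,_)

-- Steps: U = (1,1), D = (1,-1), H = (2,0).
data Step : Set where
  U D H : Step

stepWidth : Step → ℕ
stepWidth U = 1
stepWidth D = 1
stepWidth H = 2

width : List Step → ℕ
width []       = 0
width (s ∷ ss) = stepWidth s + width ss

noH : List Step → Bool
noH []       = true
noH (U ∷ ss) = noH ss
noH (D ∷ ss) = noH ss
noH (H ∷ ss) = false

nonNegFrom : ℕ → List Step → Bool
nonNegFrom zero    []       = true
nonNegFrom (suc h) []       = false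
nonNegFrom h       (U ∷ ss) = nonNegFrom (suc h) ss
nonNegFrom zero    (D ∷ ss) = false
nonNegFrom (suc h) (D ∷ ss) = nonNegFrom h ss
nonNegFrom h       (H ∷ ss) = nonNegFrom h ss

isSchroeder : ℕ → List Step → Bool
isSchroeder n p = (width p ≡ᵇ (2 * n)) ∧ nonNegFrom 0 p

isDyck : ℕ → List Step → Bool
isDyck n p = isSchroeder n p ∧ noH p

-- mirror image under x ↦ 2n - x: reverse the step order, swap U and D
mirrorStep : Step → Step
mirrorStep U = D
mirrorStep D = U
mirrorStep H = H

mirror : List Step → List Step
mirror p = reverse (map mirrorStep p)

stepEq : Step → Step → Bool
stepEq U U = true
stepEq D D = true
stepEq H H = true
stepEq _ _ = false

pathEq : List Step → List Step → Bool
pathEq []       []       = true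
pathEq (a ∷ as) (b ∷ bs) = stepEq a b ∧ pathEq as bs
pathEq _        _        = false

splits : List Step → List (List Step × List Step)
splits []       = ([] , []) ∷ []
splits (s ∷ ss) = ([] , s ∷ ss) ∷ map (λ { (q , r) → (s ∷ q , r) }) (splits ss)

-- symmetric (length 2n): p = q ++ r where q ends at x-coordinate n
-- (so p passes through a lattice point with x = n) and r is the mirror
-- image of q.
isSymmetric : ℕ → List Step → Bool
isSymmetric n p = any (λ { (q , r) → (width q ≡ᵇ n) ∧ pathEq r (mirror q) }) (splits p)

words : ℕ → List (List Step)
words zero    = [] ∷ []
words (suc k) = concatMap (λ w → (U ∷ w) ∷ (D ∷ w) ∷ (H ∷ w) ∷ []) (words k)

-- all step words with at most 2n steps (every path of width 2n is among them)
candidates : ℕ → List (List Step)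
candidates n = concatMap words (upTo (suc (2 * n)))

s : ℕ → ℕ
s n = length (filterᵇ (λ p → isSchroeder n p ∧ isSymmetric n p) (candidates n))

d : ℕ → ℕ
d n = length (filterᵇ (λ p → isDyck n p ∧ isSymmetric n p) (candidates n))

module Submission where

-- A symmetric path of length 2n is q ++ mirror q for a unique left half q
-- of width n, and it stays weakly above the axis exactly when q does
-- (mirror q retraces q backwards).  So s n counts the "half-paths" of
-- width n (words that never go below the axis) and d m counts the U/D
-- half-paths with m steps.  Deleting the k H steps of a half-path of width
-- n leaves a U/D half-path with m = n - 2k steps, and each U/D half-path
-- arises from exactly C(m+k, k) = C(n-k, n-2k) placements of the H steps.

open import Defs
open import Data.Nat using (ℕ; zero; suc; _+_; _∸_; _*_; ⌊_/2⌋; _≡ᵇ_; _<_; _≤_; z≤n; s≤s)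
open import Data.Nat.Properties
open import Data.Nat.Combinatorics using (_C_; nCn≡1; nCk≡nC[n∸k]; nCk+nC[k+1]≡[n+1]C[k+1])
open import Data.Nat.ListAction using (sum)
open import Data.Nat.ListAction.Properties using (sum-++)
open import Data.Nat.Tactic.RingSolver using (solve-∀)
open import Data.Bool using (Bool; true; false; _∧_; _∨_)
open import Data.Bool.Properties using (T-≡; ∧-identityʳ; ∧-zeroʳ; ∧-idem; ∧-comm; ∨-zeroʳ)
open import Data.Bool.ListAction using (any; or)
open import Data.List using (List; []; _∷_; _++_; map; upTo; applyUpTo; concatMap; length; filterᵇ)
open import Data.List.Properties
  using (map-++; map-∘; map-cong; map-upTo; length-++; length-map; length-reverse; unfold-reverse; ++-assoc; ++-identityʳ; ∷-injectiveˡ; ∷-injectiveʳ)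
open import Data.Product using (Σ; _×_; _,_; proj₁; proj₂)
open import Data.Empty using (⊥-elim)
open import Function using (_∘_)
open import Function.Bundles using (Equivalence)
open import Relation.Binary.PropositionalEquality
open ≡-Reasoning

-- 1. Finite sums

𝟙 : Bool → ℕ
𝟙 true  = 1
𝟙 false = 0

𝟙-∧ : ∀ a b → 𝟙 (a ∧ b) ≡ 𝟙 a * 𝟙 b
𝟙-∧ true  b = sym (+-identityʳ (𝟙 b))
𝟙-∧ false b = refl

length-filterᵇ : ∀ {A : Set} (P : A → Bool) xs →
  length (filterᵇ P xs) ≡ sum (map (λ x → 𝟙 (P x)) xs)
length-filterᵇ P []       = refl
length-filterᵇ P (x ∷ xs) with P x
... | true  = cong suc (length-filterᵇ P xs)
... | false = length-filterᵇ P xs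

sum-concatMap : ∀ {A B : Set} (f : B → ℕ) (g : A → List B) xs →
  sum (map f (concatMap g xs)) ≡ sum (map (λ x → sum (map f (g x))) xs)
sum-concatMap f g []       = refl
sum-concatMap f g (x ∷ xs) = begin
  sum (map f (g x ++ concatMap g xs))
    ≡⟨ cong sum (map-++ f (g x) (concatMap g xs)) ⟩
  sum (map f (g x) ++ map f (concatMap g xs))
    ≡⟨ sum-++ (map f (g x)) (map f (concatMap g xs)) ⟩
  sum (map f (g x)) + sum (map f (concatMap g xs))
    ≡⟨ cong (sum (map f (g x)) +_) (sum-concatMap f g xs) ⟩
  sum (map f (g x)) + sum (map (λ y → sum (map f (g y))) xs) ∎

-- Σ< B f = f 0 + … + f (B - 1).  By the definition of applyUpTo it unfolds
-- as  Σ< (suc B) f = f 0 + Σ< B (f ∘ suc).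
Σ< : ℕ → (ℕ → ℕ) → ℕ
Σ< B f = sum (applyUpTo f B)

Σ<-cong : ∀ B {f g : ℕ → ℕ} → (∀ k → k < B → f k ≡ g k) → Σ< B f ≡ Σ< B g
Σ<-cong zero    e = refl
Σ<-cong (suc B) e = cong₂ _+_ (e 0 (s≤s z≤n)) (Σ<-cong B (λ k k<B → e (suc k) (s≤s k<B)))

Σ<-zero : ∀ B → Σ< B (λ _ → 0) ≡ 0
Σ<-zero zero    = refl
Σ<-zero (suc B) = Σ<-zero B

+-interchange : ∀ a b c d → a + b + (c + d) ≡ a + c + (b + d)
+-interchange = solve-∀

Σ<-+ : ∀ B (f g : ℕ → ℕ) → Σ< B (λ k → f k + g k) ≡ Σ< B f + Σ< B g
Σ<-+ zero    f g = refl
Σ<-+ (suc B) f g = begin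
  f 0 + g 0 + Σ< B (λ k → f (suc k) + g (suc k))
    ≡⟨ cong (f 0 + g 0 +_) (Σ<-+ B (f ∘ suc) (g ∘ suc)) ⟩
  f 0 + g 0 + (Σ< B (f ∘ suc) + Σ< B (g ∘ suc))
    ≡⟨ +-interchange (f 0) (g 0) _ _ ⟩
  f 0 + Σ< B (f ∘ suc) + (g 0 + Σ< B (g ∘ suc)) ∎

Σ<-evens : ∀ m (E : ℕ → ℕ) → (∀ a → E (suc (a + a)) ≡ 0) →
  Σ< (suc (m + m)) E ≡ Σ< (suc m) (λ a → E (a + a))
Σ<-evens zero    E odd = refl
Σ<-evens (suc m) E odd rewrite +-suc m m | odd 0 =
  cong (E 0 +_) (trans (Σ<-evens m (E ∘ suc ∘ suc) odd′)
    (Σ<-cong (suc m) (λ a _ → cong E (cong suc (sym (+-suc a a))))))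
  where
  odd′ : ∀ a → E (suc (suc (suc (a + a)))) ≡ 0
  odd′ a = trans (cong (E ∘ suc) (sym (+-suc (suc a) a))) (odd (suc a))

Σwords : ℕ → (List Step → ℕ) → ℕ
Σwords zero    f = f []
Σwords (suc k) f = Σwords k (f ∘ (U ∷_)) + Σwords k (f ∘ (D ∷_)) + Σwords k (f ∘ (H ∷_))

Σwords-cong : ∀ k {f g : List Step → ℕ} → (∀ w → length w ≡ k → f w ≡ g w) →
  Σwords k f ≡ Σwords k g
Σwords-cong zero    e = e [] refl
Σwords-cong (suc k) e =
  cong₂ _+_ (cong₂ _+_ (Σwords-cong k (λ w l → e (U ∷ w) (cong suc l)))
                       (Σwords-cong k (λ w l → e (D ∷ w) (cong suc l))))
            (Σwords-cong k (λ w l → e (H ∷ w) (cong suc l)))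

Σwords-zero : ∀ k → Σwords k (λ _ → 0) ≡ 0
Σwords-zero zero    = refl
Σwords-zero (suc k) rewrite Σwords-zero k = refl

Σwords-+ : ∀ k (f g : List Step → ℕ) → Σwords k (λ w → f w + g w) ≡ Σwords k f + Σwords k g
Σwords-+ zero    f g = refl
Σwords-+ (suc k) f g =
  trans (cong₂ _+_ (cong₂ _+_ (Σwords-+ k (f ∘ (U ∷_)) (g ∘ (U ∷_))) (Σwords-+ k (f ∘ (D ∷_)) (g ∘ (D ∷_))))
                   (Σwords-+ k (f ∘ (H ∷_)) (g ∘ (H ∷_))))
        (+-interchange₃ (Σf U) (Σg U) (Σf D) (Σg D) (Σf H) (Σg H))
  where
  Σf Σg : Step → ℕ
  Σf x = Σwords k (f ∘ (x ∷_))
  Σg x = Σwords k (g ∘ (x ∷_))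
  +-interchange₃ : ∀ a b c d e f → a + b + (c + d) + (e + f) ≡ a + c + e + (b + d + f)
  +-interchange₃ = solve-∀

sum-words : ∀ k f → sum (map f (words k)) ≡ Σwords k f
sum-words zero    f = +-identityʳ (f [])
sum-words (suc k) f = begin
  sum (map f (concatMap three (words k)))
    ≡⟨ sum-concatMap f three (words k) ⟩
  sum (map (λ w → fU w + (fD w + (fH w + 0))) (words k))
    ≡⟨ sum-words k _ ⟩
  Σwords k (λ w → fU w + (fD w + (fH w + 0)))
    ≡⟨ Σwords-cong k (λ w _ → trans (sym (+-assoc (fU w) (fD w) _)) (cong (fU w + fD w +_) (+-identityʳ (fH w)))) ⟩
  Σwords k (λ w → fU w + fD w + fH w)
    ≡⟨ Σwords-+ k _ fH ⟩
  Σwords k (λ w → fU w + fD w) + Σwords k fH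
    ≡⟨ cong (_+ Σwords k fH) (Σwords-+ k fU fD) ⟩
  Σwords k fU + Σwords k fD + Σwords k fH ∎
  where
  three : List Step → List (List Step)
  three w = (U ∷ w) ∷ (D ∷ w) ∷ (H ∷ w) ∷ []
  fU fD fH : List Step → ℕ
  fU = f ∘ (U ∷_)
  fD = f ∘ (D ∷_)
  fH = f ∘ (H ∷_)

Σwords-++ : ∀ a b f → Σwords (a + b) f ≡ Σwords a (λ q → Σwords b (λ r → f (q ++ r)))
Σwords-++ zero    b f = refl
Σwords-++ (suc a) b f =
  cong₂ _+_ (cong₂ _+_ (Σwords-++ a b (f ∘ (U ∷_))) (Σwords-++ a b (f ∘ (D ∷_))))
            (Σwords-++ a b (f ∘ (H ∷_)))

Σwidth : ℕ → (List Step → ℕ) → ℕ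
Σwidth zero          f = f []
Σwidth (suc zero)    f = Σwidth zero (f ∘ (U ∷_)) + Σwidth zero (f ∘ (D ∷_))
Σwidth (suc (suc n)) f =
  Σwidth (suc n) (f ∘ (U ∷_)) + Σwidth (suc n) (f ∘ (D ∷_)) + Σwidth n (f ∘ (H ∷_))

Σwidth-cong : ∀ n {f g : List Step → ℕ} → (∀ w → f w ≡ g w) → Σwidth n f ≡ Σwidth n g
Σwidth-cong zero          e = e []
Σwidth-cong (suc zero)    e = cong₂ _+_ (e _) (e _)
Σwidth-cong (suc (suc n)) e =
  cong₂ _+_ (cong₂ _+_ (Σwidth-cong (suc n) (e ∘ (U ∷_))) (Σwidth-cong (suc n) (e ∘ (D ∷_))))
            (Σwidth-cong n (e ∘ (H ∷_)))

Σwidth-zero : ∀ n → Σwidth n (λ _ → 0) ≡ 0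
Σwidth-zero zero          = refl
Σwidth-zero (suc zero)    = refl
Σwidth-zero (suc (suc n)) rewrite Σwidth-zero (suc n) | Σwidth-zero n = refl

-- Sorting words by length: a word of width n has at most n steps, so the
-- words of width n are the words of length a < B whose width is n, for
-- any bound B > n.
Σwords-of-width : ∀ n B → n < B → ∀ g →
  Σ< B (λ a → Σwords a (λ q → 𝟙 (width q ≡ᵇ n) * g q)) ≡ Σwidth n g
Σwords-of-width zero (suc B) _ g =
  trans (cong₂ _+_ (+-identityʳ (g []))
                   (trans (Σ<-cong B (λ a _ → Σwords-zero (suc a))) (Σ<-zero B)))
        (+-identityʳ (g []))
Σwords-of-width (suc zero) (suc zero) (s≤s ())
Σwords-of-width (suc zero) (suc (suc B)) _ g = begin
  Σ< (suc B) (λ a → fU a + fD a + Σwords a (λ _ → 0))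
    ≡⟨ Σ<-cong (suc B) (λ a _ → trans (cong (fU a + fD a +_) (Σwords-zero a)) (+-identityʳ _)) ⟩
  Σ< (suc B) (λ a → fU a + fD a)
    ≡⟨ Σ<-+ (suc B) fU fD ⟩
  Σ< (suc B) fU + Σ< (suc B) fD
    ≡⟨ cong₂ _+_ (Σwords-of-width zero (suc B) (s≤s z≤n) (g ∘ (U ∷_)))
                 (Σwords-of-width zero (suc B) (s≤s z≤n) (g ∘ (D ∷_))) ⟩
  Σwidth 1 g ∎
  where
  fU fD : ℕ → ℕ
  fU a = Σwords a (λ w → 𝟙 (width w ≡ᵇ 0) * g (U ∷ w))
  fD a = Σwords a (λ w → 𝟙 (width w ≡ᵇ 0) * g (D ∷ w))
Σwords-of-width (suc (suc n)) (suc B) (s≤s n<B) g =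
  trans (Σ<-+ B _ _)
    (cong₂ _+_ (trans (Σ<-+ B _ _) (cong₂ _+_ (Σwords-of-width (suc n) B n<B _)
                                            (Σwords-of-width (suc n) B n<B _)))
               (Σwords-of-width n B (<-trans (n<1+n n) n<B) _))

-- 2. Mirror images, symmetric words and half-paths

≡ᵇ-sound : ∀ m n → (m ≡ᵇ n) ≡ true → m ≡ n
≡ᵇ-sound m n e = ≡ᵇ⇒≡ m n (Equivalence.from T-≡ e)

≡ᵇ-complete : ∀ m n → m ≡ n → (m ≡ᵇ n) ≡ true
≡ᵇ-complete m n e = Equivalence.to T-≡ (≡⇒≡ᵇ m n e)

twice : ∀ a → 2 * a ≡ a + a
twice a = cong (a +_) (+-identityʳ a)

double-injective : ∀ a b → a + a ≡ b + b → a ≡ b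
double-injective a b e = *-cancelˡ-≡ a b 2 (trans (twice a) (trans e (sym (twice b))))

double≢odd : ∀ a b → b + b ≢ suc (a + a)
double≢odd a b e = even≢odd b a (trans (twice b) (trans e (cong suc (sym (twice a)))))

pathEq-refl : ∀ p → pathEq p p ≡ true
pathEq-refl []      = refl
pathEq-refl (U ∷ p) = pathEq-refl p
pathEq-refl (D ∷ p) = pathEq-refl p
pathEq-refl (H ∷ p) = pathEq-refl p

pathEq-sound : ∀ p q → pathEq p q ≡ true → p ≡ q
pathEq-sound []      []      _ = refl
pathEq-sound (U ∷ p) (U ∷ q) e = cong (U ∷_) (pathEq-sound p q e)
pathEq-sound (D ∷ p) (D ∷ q) e = cong (D ∷_) (pathEq-sound p q e)
pathEq-sound (H ∷ p) (H ∷ q) e = cong (H ∷_) (pathEq-sound p q e)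
pathEq-sound []      (_ ∷ _) ()
pathEq-sound (_ ∷ _) []      ()
pathEq-sound (U ∷ p) (D ∷ q) ()
pathEq-sound (U ∷ p) (H ∷ q) ()
pathEq-sound (D ∷ p) (U ∷ q) ()
pathEq-sound (D ∷ p) (H ∷ q) ()
pathEq-sound (H ∷ p) (U ∷ q) ()
pathEq-sound (H ∷ p) (D ∷ q) ()

mirror-∷ : ∀ x q t → mirror (x ∷ q) ++ t ≡ mirror q ++ (mirrorStep x ∷ t)
mirror-∷ x q t = begin
  mirror (x ∷ q) ++ t                          ≡⟨ cong (_++ t) (unfold-reverse (mirrorStep x) (map mirrorStep q)) ⟩
  (mirror q ++ (mirrorStep x ∷ [])) ++ t       ≡⟨ ++-assoc (mirror q) (mirrorStep x ∷ []) t ⟩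
  mirror q ++ (mirrorStep x ∷ t)               ∎

length-mirror : ∀ q → length (mirror q) ≡ length q
length-mirror q = trans (length-reverse (map mirrorStep q)) (length-map mirrorStep q)

width-++ : ∀ q r → width (q ++ r) ≡ width q + width r
width-++ []      r = refl
width-++ (x ∷ q) r = trans (cong (stepWidth x +_) (width-++ q r)) (sym (+-assoc (stepWidth x) (width q) (width r)))

width-mirror-++ : ∀ q t → width (mirror q ++ t) ≡ width q + width t
width-mirror-++ []      t = refl
width-mirror-++ (x ∷ q) t = begin
  width (mirror (x ∷ q) ++ t)                    ≡⟨ cong width (mirror-∷ x q t) ⟩
  width (mirror q ++ (mirrorStep x ∷ t))         ≡⟨ width-mirror-++ q (mirrorStep x ∷ t) ⟩
  width q + (stepWidth (mirrorStep x) + width t) ≡⟨ cong (λ w → width q + (w + width t)) (stepWidth-mirror x) ⟩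
  width q + (stepWidth x + width t)              ≡⟨ sym (+-assoc (width q) (stepWidth x) (width t)) ⟩
  width q + stepWidth x + width t                ≡⟨ cong (_+ width t) (+-comm (width q) (stepWidth x)) ⟩
  stepWidth x + width q + width t                ∎
  where
  stepWidth-mirror : ∀ x → stepWidth (mirrorStep x) ≡ stepWidth x
  stepWidth-mirror U = refl
  stepWidth-mirror D = refl
  stepWidth-mirror H = refl

width-symmetric : ∀ q → width (q ++ mirror q) ≡ width q + width q
width-symmetric q = begin
  width (q ++ mirror q)            ≡⟨ width-++ q (mirror q) ⟩
  width q + width (mirror q)       ≡⟨ cong (λ t → width q + width t) (sym (++-identityʳ (mirror q))) ⟩
  width q + width (mirror q ++ []) ≡⟨ cong (width q +_) (trans (width-mirror-++ q []) (+-identityʳ (width q))) ⟩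
  width q + width q                ∎

Split : Set
Split = List Step × List Step

any-map : ∀ {A B : Set} (g : B → Bool) (h : A → B) xs → any g (map h xs) ≡ any (g ∘ h) xs
any-map g h xs = cong or (sym (map-∘ xs))

splits-sound : ∀ (g : Split → Bool) p → any g (splits p) ≡ true →
  Σ Split λ x → g x ≡ true × proj₁ x ++ proj₂ x ≡ p
splits-sound g [] e with g ([] , []) in gx
... | true = ([] , []) , gx , refl
splits-sound g (x ∷ p) e with g ([] , x ∷ p) in gx
... | true  = ([] , x ∷ p) , gx , refl
... | false with splits-sound (λ y → g (x ∷ proj₁ y , proj₂ y)) p (trans (sym (any-map g _ (splits p))) e)
...   | (q , r) , gqr , qr≡p = (x ∷ q , r) , gqr , cong (x ∷_) qr≡p

splits-complete : ∀ (g : Split → Bool) q r → g (q , r) ≡ true → any g (splits (q ++ r)) ≡ true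
splits-complete g []      []      e rewrite e = refl
splits-complete g []      (_ ∷ _) e rewrite e = refl
splits-complete g (x ∷ q) r       e = begin
  g ([] , x ∷ q ++ r) ∨ any g (map _ (splits (q ++ r)))
    ≡⟨ cong (g ([] , x ∷ q ++ r) ∨_) (any-map g _ (splits (q ++ r))) ⟩
  g ([] , x ∷ q ++ r) ∨ any (λ y → g (x ∷ proj₁ y , proj₂ y)) (splits (q ++ r))
    ≡⟨ cong (g ([] , x ∷ q ++ r) ∨_) (splits-complete (λ y → g (x ∷ proj₁ y , proj₂ y)) q r e) ⟩
  g ([] , x ∷ q ++ r) ∨ true
    ≡⟨ ∨-zeroʳ _ ⟩
  true ∎

∧-true-l : ∀ a b → (a ∧ b) ≡ true → a ≡ true
∧-true-l true b e = refl

∧-true-r : ∀ a b → (a ∧ b) ≡ true → b ≡ true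
∧-true-r true b e = e

symmetric-sound : ∀ n p → isSymmetric n p ≡ true →
  Σ (List Step) λ q → p ≡ q ++ mirror q × width q ≡ n
symmetric-sound n p e with splits-sound _ p e
... | (q , r) , gqr , qr≡p =
  q , trans (sym qr≡p) (cong (q ++_) (pathEq-sound r (mirror q) (∧-true-r _ _ gqr)))
    , ≡ᵇ-sound (width q) n (∧-true-l _ _ gqr)

symmetric-complete : ∀ n q → width q ≡ n → isSymmetric n (q ++ mirror q) ≡ true
symmetric-complete n q w =
  splits-complete _ q (mirror q)
    (cong₂ _∧_ (≡ᵇ-complete (width q) n w) (pathEq-refl (mirror q)))

length-symmetric : ∀ q → length (q ++ mirror q) ≡ length q + length q
length-symmetric q = trans (length-++ q) (cong (length q +_) (length-mirror q))

++-equal-length : ∀ (q q′ r r′ : List Step) → length q ≡ length q′ → q ++ r ≡ q′ ++ r′ →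
  q ≡ q′ × r ≡ r′
++-equal-length []      []       r r′ _ e = refl , e
++-equal-length (x ∷ q) (y ∷ q′) r r′ l e with ++-equal-length q q′ r r′ (suc-injective l) (∷-injectiveʳ e)
... | q≡q′ , r≡r′ = cong₂ _∷_ (∷-injectiveˡ e) q≡q′ , r≡r′

symmetric-odd : ∀ n p a → isSymmetric n p ≡ true → length p ≢ suc (a + a)
symmetric-odd n p a e odd with symmetric-sound n p e
... | q , p≡ , _ = double≢odd a (length q) (trans (sym (length-symmetric q)) (trans (cong length (sym p≡)) odd))

symmetric-halves : ∀ n q r → length r ≡ length q → isSymmetric n (q ++ r) ≡ true →
  r ≡ mirror q × width q ≡ n
symmetric-halves n q r lr e with symmetric-sound n (q ++ r) e
... | q′ , qr≡ , w with ++-equal-length q q′ r (mirror q′) (double-injective _ _ lengths) qr≡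
  where
  lengths : length q + length q ≡ length q′ + length q′
  lengths = begin
    length q + length q  ≡⟨ cong (length q +_) (sym lr) ⟩
    length q + length r  ≡⟨ sym (length-++ q) ⟩
    length (q ++ r)      ≡⟨ cong length qr≡ ⟩
    length (q′ ++ mirror q′) ≡⟨ length-symmetric q′ ⟩
    length q′ + length q′ ∎
... | refl , r≡ = r≡ , w

-- neverBelow h q : starting at height h, the word q never goes below the
-- axis (it may end at any height).  A half-path is a word q with
-- neverBelow 0 q.
neverBelow : ℕ → List Step → Bool
neverBelow h       []      = true
neverBelow h       (U ∷ q) = neverBelow (suc h) q
neverBelow zero    (D ∷ q) = false
neverBelow (suc h) (D ∷ q) = neverBelow h q
neverBelow h       (H ∷ q) = neverBelow h q

-- The height reached after q from height h (meaningful when neverBelow h q).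
heightAfter : ℕ → List Step → ℕ
heightAfter h       []      = h
heightAfter h       (U ∷ q) = heightAfter (suc h) q
heightAfter zero    (D ∷ q) = zero
heightAfter (suc h) (D ∷ q) = heightAfter h q
heightAfter h       (H ∷ q) = heightAfter h q

nonNegFrom-++ : ∀ h q t → nonNegFrom h (q ++ t) ≡ neverBelow h q ∧ nonNegFrom (heightAfter h q) t
nonNegFrom-++ h       []      t = refl
nonNegFrom-++ zero    (U ∷ q) t = nonNegFrom-++ 1 q t
nonNegFrom-++ (suc h) (U ∷ q) t = nonNegFrom-++ (suc (suc h)) q t
nonNegFrom-++ zero    (D ∷ q) t = refl
nonNegFrom-++ (suc h) (D ∷ q) t = nonNegFrom-++ h q t
nonNegFrom-++ zero    (H ∷ q) t = nonNegFrom-++ zero q t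
nonNegFrom-++ (suc h) (H ∷ q) t = nonNegFrom-++ (suc h) q t

nonNegFrom-mirror : ∀ h q t → neverBelow h q ≡ true →
  nonNegFrom (heightAfter h q) (mirror q ++ t) ≡ nonNegFrom h t
nonNegFrom-mirror h             []      t e = refl
nonNegFrom-mirror zero          (U ∷ q) t e rewrite mirror-∷ U q t = nonNegFrom-mirror 1 q (D ∷ t) e
nonNegFrom-mirror (suc h)       (U ∷ q) t e rewrite mirror-∷ U q t = nonNegFrom-mirror (suc (suc h)) q (D ∷ t) e
nonNegFrom-mirror (suc zero)    (D ∷ q) t e rewrite mirror-∷ D q t = nonNegFrom-mirror zero q (U ∷ t) e
nonNegFrom-mirror (suc (suc h)) (D ∷ q) t e rewrite mirror-∷ D q t = nonNegFrom-mirror (suc h) q (U ∷ t) e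
nonNegFrom-mirror zero          (H ∷ q) t e rewrite mirror-∷ H q t = nonNegFrom-mirror zero q (H ∷ t) e
nonNegFrom-mirror (suc h)       (H ∷ q) t e rewrite mirror-∷ H q t = nonNegFrom-mirror (suc h) q (H ∷ t) e

nonNeg-symmetric : ∀ q → nonNegFrom 0 (q ++ mirror q) ≡ neverBelow 0 q
nonNeg-symmetric q rewrite nonNegFrom-++ 0 q (mirror q) with neverBelow 0 q in valid
... | false = refl
... | true  = begin
  nonNegFrom (heightAfter 0 q) (mirror q)       ≡⟨ cong (nonNegFrom (heightAfter 0 q)) (sym (++-identityʳ (mirror q))) ⟩
  nonNegFrom (heightAfter 0 q) (mirror q ++ []) ≡⟨ nonNegFrom-mirror 0 q [] valid ⟩
  true                                          ∎

noH-++ : ∀ q r → noH (q ++ r) ≡ noH q ∧ noH r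
noH-++ []      r = refl
noH-++ (U ∷ q) r = noH-++ q r
noH-++ (D ∷ q) r = noH-++ q r
noH-++ (H ∷ q) r = refl

noH-mirror-++ : ∀ q t → noH (mirror q ++ t) ≡ noH q ∧ noH t
noH-mirror-++ []      t = refl
noH-mirror-++ (U ∷ q) t rewrite mirror-∷ U q t = noH-mirror-++ q (D ∷ t)
noH-mirror-++ (D ∷ q) t rewrite mirror-∷ D q t = noH-mirror-++ q (U ∷ t)
noH-mirror-++ (H ∷ q) t rewrite mirror-∷ H q t | noH-mirror-++ q (H ∷ t) = ∧-zeroʳ (noH q)

noH-symmetric : ∀ q → noH (q ++ mirror q) ≡ noH q
noH-symmetric q = begin
  noH (q ++ mirror q)              ≡⟨ noH-++ q (mirror q) ⟩
  noH q ∧ noH (mirror q)           ≡⟨ cong (λ t → noH q ∧ noH t) (sym (++-identityʳ (mirror q))) ⟩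
  noH q ∧ noH (mirror q ++ [])     ≡⟨ cong (noH q ∧_) (trans (noH-mirror-++ q []) (∧-identityʳ (noH q))) ⟩
  noH q ∧ noH q                    ≡⟨ ∧-idem (noH q) ⟩
  noH q                            ∎

-- 3. Counting symmetric paths by their left halves

-- Symmetric Schröder paths of length 2n with an extra property Z; Z = noH
-- gives the symmetric Dyck paths, Z = const true all symmetric Schröder paths.
symmetricWith : (List Step → Bool) → ℕ → List Step → Bool
symmetricWith Z n p = (isSchroeder n p ∧ Z p) ∧ isSymmetric n p

symmetricWith-mirror : ∀ Z n q → symmetricWith Z n (q ++ mirror q) ≡
  (width q ≡ᵇ n) ∧ (neverBelow 0 q ∧ Z (q ++ mirror q))
symmetricWith-mirror Z n q with width q ≡ᵇ n in w
... | true
  rewrite symmetric-complete n q (≡ᵇ-sound (width q) n w)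
        | width-symmetric q | ≡ᵇ-sound (width q) n w
        | +-identityʳ n | ≡ᵇ-complete (n + n) (n + n) refl
        | nonNeg-symmetric q
  = ∧-identityʳ _
... | false with isSymmetric n (q ++ mirror q) in symmetric
...   | false = ∧-zeroʳ _
...   | true with proj₂ (symmetric-halves n q (mirror q) (length-mirror q) symmetric)
...     | width≡n with () ← trans (sym (≡ᵇ-complete (width q) n width≡n)) w

symmetricWith-halves : ∀ Z n q r → length r ≡ length q → symmetricWith Z n (q ++ r) ≡
  pathEq r (mirror q) ∧ ((width q ≡ᵇ n) ∧ (neverBelow 0 q ∧ Z (q ++ mirror q)))
symmetricWith-halves Z n q r lr with pathEq r (mirror q) in mirrored
... | true rewrite pathEq-sound r (mirror q) mirrored = symmetricWith-mirror Z n q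
... | false with isSymmetric n (q ++ r) in symmetric
...   | false = ∧-zeroʳ _
...   | true with proj₁ (symmetric-halves n q r lr symmetric)
...     | refl with () ← trans (sym (pathEq-refl (mirror q))) mirrored

Σwords-pathEq : ∀ a t c → length t ≡ a → Σwords a (λ r → 𝟙 (pathEq r t) * c) ≡ c
Σwords-pathEq zero    []      c _ = +-identityʳ c
Σwords-pathEq (suc a) (U ∷ t) c l
  rewrite Σwords-zero a | Σwords-pathEq a t c (suc-injective l) = trans (+-identityʳ (c + 0)) (+-identityʳ c)
Σwords-pathEq (suc a) (D ∷ t) c l
  rewrite Σwords-zero a | Σwords-pathEq a t c (suc-injective l) = +-identityʳ c
Σwords-pathEq (suc a) (H ∷ t) c l
  rewrite Σwords-zero a | Σwords-pathEq a t c (suc-injective l) = refl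

count-odd-length : ∀ Z n a → Σwords (suc (a + a)) (λ p → 𝟙 (symmetricWith Z n p)) ≡ 0
count-odd-length Z n a = trans (Σwords-cong (suc (a + a)) vanishes) (Σwords-zero (suc (a + a)))
  where
  vanishes : ∀ p → length p ≡ suc (a + a) → 𝟙 (symmetricWith Z n p) ≡ 0
  vanishes p lp with isSymmetric n p in symmetric
  ... | false rewrite ∧-zeroʳ (isSchroeder n p ∧ Z p) = refl
  ... | true  = ⊥-elim (symmetric-odd n p a symmetric lp)

-- A symmetric word of length 2a is determined by its left half q of
-- length a.
count-even-length : ∀ Z n a → Σwords (a + a) (λ p → 𝟙 (symmetricWith Z n p)) ≡
  Σwords a (λ q → 𝟙 (width q ≡ᵇ n) * 𝟙 (neverBelow 0 q ∧ Z (q ++ mirror q)))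
count-even-length Z n a = begin
  Σwords (a + a) (λ p → 𝟙 (symmetricWith Z n p))
    ≡⟨ Σwords-++ a a _ ⟩
  Σwords a (λ q → Σwords a (λ r → 𝟙 (symmetricWith Z n (q ++ r))))
    ≡⟨ Σwords-cong a (λ q lq → Σwords-cong a (λ r lr →
         trans (cong 𝟙 (symmetricWith-halves Z n q r (trans lr (sym lq))))
               (𝟙-∧ (pathEq r (mirror q)) _))) ⟩
  Σwords a (λ q → Σwords a (λ r → 𝟙 (pathEq r (mirror q)) * 𝟙 (half q)))
    ≡⟨ Σwords-cong a (λ q lq → Σwords-pathEq a (mirror q) _ (trans (length-mirror q) lq)) ⟩
  Σwords a (λ q → 𝟙 (half q))
    ≡⟨ Σwords-cong a (λ q _ → 𝟙-∧ (width q ≡ᵇ n) _) ⟩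
  Σwords a (λ q → 𝟙 (width q ≡ᵇ n) * 𝟙 (neverBelow 0 q ∧ Z (q ++ mirror q))) ∎
  where
  half : List Step → Bool
  half q = (width q ≡ᵇ n) ∧ (neverBelow 0 q ∧ Z (q ++ mirror q))

count-symmetric : ∀ Z n → length (filterᵇ (symmetricWith Z n) (candidates n)) ≡
  Σwidth n (λ q → 𝟙 (neverBelow 0 q ∧ Z (q ++ mirror q)))
count-symmetric Z n = begin
  length (filterᵇ P (candidates n))
    ≡⟨ length-filterᵇ P (candidates n) ⟩
  sum (map count (concatMap words (upTo (suc (2 * n)))))
    ≡⟨ sum-concatMap count words (upTo (suc (2 * n))) ⟩
  sum (map (λ k → sum (map count (words k))) (upTo (suc (2 * n))))
    ≡⟨ cong sum (map-upTo _ (suc (2 * n))) ⟩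
  Σ< (suc (2 * n)) (λ k → sum (map count (words k)))
    ≡⟨ Σ<-cong (suc (2 * n)) (λ k _ → sum-words k count) ⟩
  Σ< (suc (2 * n)) (λ k → Σwords k count)
    ≡⟨ cong (λ m → Σ< (suc m) (λ k → Σwords k count)) (twice n) ⟩
  Σ< (suc (n + n)) (λ k → Σwords k count)
    ≡⟨ Σ<-evens n (λ k → Σwords k count) (count-odd-length Z n) ⟩
  Σ< (suc n) (λ a → Σwords (a + a) count)
    ≡⟨ Σ<-cong (suc n) (λ a _ → count-even-length Z n a) ⟩
  Σ< (suc n) (λ a → Σwords a (λ q → 𝟙 (width q ≡ᵇ n) * 𝟙 (neverBelow 0 q ∧ Z (q ++ mirror q))))
    ≡⟨ Σwords-of-width n (suc n) (n<1+n n) _ ⟩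
  Σwidth n (λ q → 𝟙 (neverBelow 0 q ∧ Z (q ++ mirror q))) ∎
  where
  P : List Step → Bool
  P = symmetricWith Z n
  count : List Step → ℕ
  count p = 𝟙 (P p)

ΣUD : ℕ → (List Step → ℕ) → ℕ
ΣUD zero    f = f []
ΣUD (suc m) f = ΣUD m (f ∘ (U ∷_)) + ΣUD m (f ∘ (D ∷_))

Σwidth-noH : ∀ m (h : List Step → Bool) → Σwidth m (λ q → 𝟙 (noH q ∧ h q)) ≡ ΣUD m (λ q → 𝟙 (h q))
Σwidth-noH zero          h = refl
Σwidth-noH (suc zero)    h = refl
Σwidth-noH (suc (suc m)) h =
  trans (cong₂ _+_ (cong₂ _+_ (Σwidth-noH (suc m) (h ∘ (U ∷_))) (Σwidth-noH (suc m) (h ∘ (D ∷_))))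
                   (Σwidth-zero m))
        (+-identityʳ _)

d-halfPaths : ∀ m → d m ≡ ΣUD m (λ q → 𝟙 (neverBelow 0 q))
d-halfPaths m = begin
  d m
    ≡⟨ count-symmetric noH m ⟩
  Σwidth m (λ q → 𝟙 (neverBelow 0 q ∧ noH (q ++ mirror q)))
    ≡⟨ Σwidth-cong m (λ q → cong 𝟙 (trans (cong (neverBelow 0 q ∧_) (noH-symmetric q)) (∧-comm (neverBelow 0 q) (noH q)))) ⟩
  Σwidth m (λ q → 𝟙 (noH q ∧ neverBelow 0 q))
    ≡⟨ Σwidth-noH m (neverBelow 0) ⟩
  ΣUD m (λ q → 𝟙 (neverBelow 0 q)) ∎

s-halfPaths : ∀ n → s n ≡ Σwidth n (λ q → 𝟙 (neverBelow 0 q))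
s-halfPaths n = begin
  s n
    ≡⟨ length-filterᵇ _ (candidates n) ⟩
  sum (map (λ p → 𝟙 (isSchroeder n p ∧ isSymmetric n p)) (candidates n))
    ≡⟨ cong sum (map-cong (λ p → cong (λ b → 𝟙 (b ∧ isSymmetric n p)) (sym (∧-identityʳ (isSchroeder n p)))) (candidates n)) ⟩
  sum (map (λ p → 𝟙 (symmetricWith (λ _ → true) n p)) (candidates n))
    ≡⟨ sym (length-filterᵇ _ (candidates n)) ⟩
  length (filterᵇ (symmetricWith (λ _ → true) n) (candidates n))
    ≡⟨ count-symmetric (λ _ → true) n ⟩
  Σwidth n (λ q → 𝟙 (neverBelow 0 q ∧ true))
    ≡⟨ Σwidth-cong n (λ q → cong 𝟙 (∧-identityʳ (neverBelow 0 q))) ⟩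
  Σwidth n (λ q → 𝟙 (neverBelow 0 q)) ∎

-- 4. Erasing H steps

erase : List Step → List Step
erase []      = []
erase (U ∷ q) = U ∷ erase q
erase (D ∷ q) = D ∷ erase q
erase (H ∷ q) = erase q

-- H steps do not change the height, so erasing them keeps half-paths
-- half-paths.
neverBelow-erase : ∀ h q → neverBelow h q ≡ neverBelow h (erase q)
neverBelow-erase h       []      = refl
neverBelow-erase h       (U ∷ q) = neverBelow-erase (suc h) q
neverBelow-erase zero    (D ∷ q) = refl
neverBelow-erase (suc h) (D ∷ q) = neverBelow-erase h q
neverBelow-erase h       (H ∷ q) = neverBelow-erase h q

-- Σdecomp n F = Σ F m k over the decompositions n = m + 2k, by recursion
-- on n (peeling off the term k = 0).
Σdecomp : ℕ → (ℕ → ℕ → ℕ) → ℕ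
Σdecomp zero          F = F 0 0
Σdecomp (suc zero)    F = F 1 0
Σdecomp (suc (suc n)) F = F (suc (suc n)) 0 + Σdecomp n (λ m k → F m (suc k))

Σdecomp-cong : ∀ n {F G : ℕ → ℕ → ℕ} → (∀ m k → F m k ≡ G m k) → Σdecomp n F ≡ Σdecomp n G
Σdecomp-cong zero          e = e 0 0
Σdecomp-cong (suc zero)    e = e 1 0
Σdecomp-cong (suc (suc n)) e = cong₂ _+_ (e _ 0) (Σdecomp-cong n (λ m k → e m (suc k)))

Σdecomp-+ : ∀ n (F G : ℕ → ℕ → ℕ) → Σdecomp n (λ m k → F m k + G m k) ≡ Σdecomp n F + Σdecomp n G
Σdecomp-+ zero          F G = refl
Σdecomp-+ (suc zero)    F G = refl
Σdecomp-+ (suc (suc n)) F G =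
  trans (cong (F (suc (suc n)) 0 + G (suc (suc n)) 0 +_) (Σdecomp-+ n (λ m k → F m (suc k)) (λ m k → G m (suc k))))
        (+-interchange (F (suc (suc n)) 0) (G (suc (suc n)) 0) _ _)

shift : (ℕ → ℕ → ℕ) → ℕ → ℕ → ℕ
shift F zero    k = 0
shift F (suc m) k = F m k

Σdecomp-shift : ∀ n F → Σdecomp (suc n) (shift F) ≡ Σdecomp n F
Σdecomp-shift zero          F = refl
Σdecomp-shift (suc zero)    F = +-identityʳ _
Σdecomp-shift (suc (suc n)) F =
  cong (F (suc (suc n)) 0 +_) (trans (Σdecomp-cong (suc n) shift-suc) (Σdecomp-shift n (λ m k → F m (suc k))))
  where
  shift-suc : ∀ m k → shift F m (suc k) ≡ shift (λ m k → F m (suc k)) m k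
  shift-suc zero    k = refl
  shift-suc (suc m) k = refl

-- interleavings m k : the number of ways to place k H steps among m other
-- steps.
interleavings : ℕ → ℕ → ℕ
interleavings m k = (m + k) C k

-- Pascal's rule: classify by whether the first step is H.
interleavings-pascal : ∀ m k → interleavings (suc m) (suc k) ≡ interleavings m (suc k) + interleavings (suc m) k
interleavings-pascal m k = begin
  (suc m + suc k) C suc k                  ≡⟨ cong (λ x → suc x C suc k) (+-suc m k) ⟩
  suc (suc (m + k)) C suc k                ≡⟨ sym (nCk+nC[k+1]≡[n+1]C[k+1] (suc (m + k)) k) ⟩
  suc (m + k) C k + suc (m + k) C suc k    ≡⟨ +-comm (suc (m + k) C k) (suc (m + k) C suc k) ⟩
  suc (m + k) C suc k + (suc m + k) C k    ≡⟨ cong (λ x → x C suc k + (suc m + k) C k) (sym (+-suc m k)) ⟩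
  (m + suc k) C suc k + (suc m + k) C k    ∎

-- erasureSum n f = Σ_{n = m + 2k} interleavings m k · ΣUD m f : every U/D
-- word of m steps, weighted by the number of words of width n erasing to it.
erasureSum : ℕ → (List Step → ℕ) → ℕ
erasureSum n f = Σdecomp n (λ m k → interleavings m k * ΣUD m f)

-- The recursion of erasureSum mirrors that of Σwidth: a word of width
-- n + 2 starts with U, D (width n + 1 remains) or H (width n remains).
erasureSum-rec : ∀ n f → erasureSum (suc (suc n)) f ≡
  erasureSum (suc n) (f ∘ (U ∷_)) + erasureSum (suc n) (f ∘ (D ∷_)) + erasureSum n f
erasureSum-rec n f = begin
  erasureSum (suc (suc n)) f
    ≡⟨⟩
  A (suc n) 0 + Σdecomp n (λ m k → interleavings m (suc k) * ΣUD m f)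
    ≡⟨ cong (A (suc n) 0 +_) (Σdecomp-cong n split-first-H) ⟩
  A (suc n) 0 + Σdecomp n (λ m k → shift A m (suc k) + interleavings m k * ΣUD m f)
    ≡⟨ cong (A (suc n) 0 +_) (Σdecomp-+ n (λ m k → shift A m (suc k)) _) ⟩
  A (suc n) 0 + (Σdecomp n (λ m k → shift A m (suc k)) + erasureSum n f)
    ≡⟨ sym (+-assoc (A (suc n) 0) _ (erasureSum n f)) ⟩
  Σdecomp (suc (suc n)) (shift A) + erasureSum n f
    ≡⟨ cong (_+ erasureSum n f) (Σdecomp-shift (suc n) A) ⟩
  Σdecomp (suc n) A + erasureSum n f
    ≡⟨ cong (_+ erasureSum n f) (Σdecomp-cong (suc n) (λ m k → *-distribˡ-+ (interleavings m k) _ _)) ⟩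
  Σdecomp (suc n) (λ m k → interleavings m k * ΣUD m (f ∘ (U ∷_)) + interleavings m k * ΣUD m (f ∘ (D ∷_)))
    + erasureSum n f
    ≡⟨ cong (_+ erasureSum n f) (Σdecomp-+ (suc n) _ _) ⟩
  erasureSum (suc n) (f ∘ (U ∷_)) + erasureSum (suc n) (f ∘ (D ∷_)) + erasureSum n f ∎
  where
  -- A m k counts words with m + 1 U/D steps and k H steps that start with
  -- U or D: the H steps are interleaved with the last m U/D steps.
  A : ℕ → ℕ → ℕ
  A m k = interleavings m k * ΣUD (suc m) f
  -- Pascal's rule: a word with m U/D steps and k + 1 H steps starts with H
  -- or with a U/D step; for m = 0 only the first case occurs.
  split-first-H : ∀ m k → interleavings m (suc k) * ΣUD m f ≡ shift A m (suc k) + interleavings m k * ΣUD m f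
  split-first-H zero    k rewrite nCn≡1 (suc k) | nCn≡1 k = refl
  split-first-H (suc m) k rewrite interleavings-pascal m k =
    *-distribʳ-+ (ΣUD (suc m) f) (interleavings m (suc k)) (interleavings (suc m) k)

Σwidth-erase : ∀ n f → Σwidth n (f ∘ erase) ≡ erasureSum n f
Σwidth-erase zero          f = sym (+-identityʳ (f []))
Σwidth-erase (suc zero)    f = sym (+-identityʳ _)
Σwidth-erase (suc (suc n)) f =
  trans (cong₂ _+_ (cong₂ _+_ (Σwidth-erase (suc n) (f ∘ (U ∷_))) (Σwidth-erase (suc n) (f ∘ (D ∷_))))
                   (Σwidth-erase n f))
        (sym (erasureSum-rec n f))

Σdecomp-as-Σ< : ∀ n F → Σdecomp n F ≡ Σ< (suc ⌊ n /2⌋) (λ k → F (n ∸ 2 * k) k)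
Σdecomp-as-Σ< zero          F = sym (+-identityʳ (F 0 0))
Σdecomp-as-Σ< (suc zero)    F = sym (+-identityʳ (F 1 0))
Σdecomp-as-Σ< (suc (suc n)) F =
  cong (F (suc (suc n)) 0 +_)
    (trans (Σdecomp-as-Σ< n (λ m k → F m (suc k)))
           (Σ<-cong (suc ⌊ n /2⌋) (λ k _ → cong (λ i → F (suc (suc n) ∸ i) (suc k)) (sym (*-suc 2 k)))))

double-≤ : ∀ n k → k < suc ⌊ n /2⌋ → 2 * k ≤ n
double-≤ n             zero    _           = z≤n
double-≤ (suc (suc n)) (suc k) (s≤s k<)    = subst (_≤ suc (suc n)) (sym (*-suc 2 k)) (s≤s (s≤s (double-≤ n k k<)))

-- With m = n - 2k: C(m + k, k) = C(m + k, m) and m + k = n - k.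
interleavings-binomial : ∀ n k → 2 * k ≤ n → interleavings (n ∸ 2 * k) k ≡ (n ∸ k) C (n ∸ 2 * k)
interleavings-binomial n k 2k≤n = begin
  (m + k) C k            ≡⟨ nCk≡nC[n∸k] (m≤n+m k m) ⟩
  (m + k) C (m + k ∸ k)  ≡⟨ cong ((m + k) C_) (m+n∸n≡m m k) ⟩
  (m + k) C m            ≡⟨ cong (_C m) (sym n∸k≡m+k) ⟩
  (n ∸ k) C m            ∎
  where
  m : ℕ
  m = n ∸ 2 * k
  n∸k≡m+k : n ∸ k ≡ m + k
  n∸k≡m+k = begin
    n ∸ k               ≡⟨ cong (_∸ k) (sym (m∸n+n≡m 2k≤n)) ⟩
    m + 2 * k ∸ k       ≡⟨ cong (λ i → m + i ∸ k) (twice k) ⟩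
    m + (k + k) ∸ k     ≡⟨ cong (_∸ k) (sym (+-assoc m k k)) ⟩
    m + k + k ∸ k       ≡⟨ m+n∸n≡m (m + k) k ⟩
    m + k               ∎

theorem3p3 : (n : ℕ) →
    s n ≡ sum (map (λ k → ((n ∸ k) C (n ∸ 2 * k)) * d (n ∸ 2 * k)) (upTo (⌊ n /2⌋ + 1)))
theorem3p3 n = begin
  s n
    ≡⟨ s-halfPaths n ⟩
  Σwidth n (λ q → 𝟙 (neverBelow 0 q))
    ≡⟨ Σwidth-cong n (λ q → cong 𝟙 (neverBelow-erase 0 q)) ⟩
  Σwidth n (λ q → 𝟙 (neverBelow 0 (erase q)))
    ≡⟨ Σwidth-erase n (λ q → 𝟙 (neverBelow 0 q)) ⟩
  erasureSum n (λ q → 𝟙 (neverBelow 0 q))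
    ≡⟨ Σdecomp-cong n (λ m k → cong (interleavings m k *_) (sym (d-halfPaths m))) ⟩
  Σdecomp n (λ m k → interleavings m k * d m)
    ≡⟨ Σdecomp-as-Σ< n (λ m k → interleavings m k * d m) ⟩
  Σ< (suc ⌊ n /2⌋) (λ k → interleavings (n ∸ 2 * k) k * d (n ∸ 2 * k))
    ≡⟨ Σ<-cong (suc ⌊ n /2⌋) (λ k k< → cong (_* d (n ∸ 2 * k)) (interleavings-binomial n k (double-≤ n k k<))) ⟩
  Σ< (suc ⌊ n /2⌋) term
    ≡⟨ cong (λ B → Σ< B term) (+-comm 1 ⌊ n /2⌋) ⟩
  Σ< (⌊ n /2⌋ + 1) term
    ≡⟨ sym (cong sum (map-upTo term (⌊ n /2⌋ + 1))) ⟩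
  sum (map term (upTo (⌊ n /2⌋ + 1))) ∎
  where
  term : ℕ → ℕ
  term k = ((n ∸ k) C (n ∸ 2 * k)) * d (n ∸ 2 * k)
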